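{- Algorithm \textsf{S} (defined below), run on an undirected graph with vertex set $[n]$, $n>1$, takes $O(\lg^2 n)$ steps.
   Context: Each edge $e$ has two ends $e.v,e.w$. Each vertex $v$ has a parent $v.p$, initially $v$; $v$ is a root if $v.p=v$. Vertices are compared as integers. Each operation is performed simultaneously for all edges/vertices using values at the start of the operation. \textsc{parent-connect}: for each edge $e$, let $x=e.v.p$, $y=e.w.p$; send $\min\{x,y\}$ to $\max\{x,y\}$. \textsc{root-update}: for each root $v$, replace $v.p$ by the minimum of $v.p$ and the vertices sent to $v$ in the preceding \textsc{parent-connect}. \textsc{shortcut}: for each vertex $v$, replace $v.p$ by $(v.p).p$. Algorithm \textsf{S}: repeat \{\textsc{parent-connect}; \textsc{root-update}; repeat \textsc{shortcut} until no parent changes\} until no parent changes. Each operation is implemented in a constant number of synchronous concurrent message-passing steps, so the number of steps is within a constant factor of the total number of operations executed. $\lg$ is the base-two logarithm. -}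

module Defs where

open import Data.Nat using (ℕ; zero; suc; _+_; _≤ᵇ_)
open import Data.Fin using (Fin; toℕ)
open import Data.Bool using (if_then_else_)
open import Data.List using (List; []; _∷_; foldr)
open import Data.Product using (_×_; _,_; proj₁; proj₂)
open import Relation.Binary.PropositionalEquality using (_≡_)
open import Relation.Nullary using (¬_; yes; no)
open import Data.Fin using (_≟_)

-- An undirected graph on vertex set [n] = Fin n, given by its list of edges;
-- each edge e has two ends (e.v , e.w).
Edge : ℕ → Set
Edge n = Fin n × Fin n

Graph : ℕ → Set
Graph n = List (Edge n)

-- parent pointers: v.p = p v
Parents : ℕ → Set
Parents n = Fin n → Fin n

minF : ∀ {n} → Fin n → Fin n → Fin n
minF a b = if toℕ a ≤ᵇ toℕ b then a else b

maxF : ∀ {n} → Fin n → Fin n → Fin n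
maxF a b = if toℕ a ≤ᵇ toℕ b then b else a

-- parent-connect followed by root-update: every root v takes the minimum of
-- v.p and all values min{x,y} sent to v (i.e. with max{x,y} = v),
-- where x = e.v.p, y = e.w.p.  Non-roots are unchanged.
received : ∀ {n} → Graph n → Parents n → Fin n → Fin n → Fin n
received E p v acc = foldr step acc E
  where
  step : _ → Fin _ → Fin _
  step (a , b) m with maxF (p a) (p b) ≟ v
  ... | yes _ = minF (minF (p a) (p b)) m
  ... | no  _ = m

connectUpdate : ∀ {n} → Graph n → Parents n → Parents n
connectUpdate E p v with p v ≟ v
... | yes _ = received E p v (p v)
... | no  _ = p v

shortcut : ∀ {n} → Parents n → Parents n
shortcut p v = p (p v)

_≐_ : ∀ {n} → Parents n → Parents n → Set
p ≐ q = ∀ v → p v ≡ q v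

-- ShortcutLoop p r k : "repeat shortcut until no parent changes", started
-- from p, ends with parents r after executing exactly k shortcut operations
-- (the last of which changes nothing).
data ShortcutLoop {n : ℕ} : Parents n → Parents n → ℕ → Set where
  sc-stop : ∀ {p} → shortcut p ≐ p → ShortcutLoop p p 1
  sc-step : ∀ {p r k} → ¬ (shortcut p ≐ p) →
            ShortcutLoop (shortcut p) r k → ShortcutLoop p r (suc k)

-- RunS E p k : Algorithm S (outer loop) started with parents p on graph E
-- terminates after executing exactly k operations in total
-- (each iteration: 1 parent-connect + 1 root-update + the shortcuts).
-- The outer loop stops after an iteration in which no parent changed.
data RunS {n : ℕ} (E : Graph n) : Parents n → ℕ → Set where
  run-stop : ∀ {p r j} →
             connectUpdate E p ≐ p →
             ShortcutLoop (connectUpdate E p) r j →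
             r ≐ connectUpdate E p →
             RunS E p (2 + j)
  run-step : ∀ {p r j k} →
             ShortcutLoop (connectUpdate E p) r j →
             ¬ (connectUpdate E p ≐ p × r ≐ connectUpdate E p) →
             RunS E r k →
             RunS E p (2 + j + k)

initial : ∀ {n} → Parents n
initial v = v

module Submission where

-- Invariant.  Between iterations the parent function s is a forest of flat
-- trees ("stars"): parents never exceed their children and s (s v) = s v.
-- One iteration hooks roots onto smaller neighbouring roots (connectUpdate)
-- and then shortcuts until the forest is flat again; since every path has
-- length at most n ≤ 2 ^ L, the shortcut loop ends after at most L + 1
-- operations, so one iteration costs at most C = L + 3 operations.
--
-- Progress.  Call a root active when some edge joins its tree to another
-- tree.  The key lemma (TwoRounds.merge, with Round.active-before) says that
-- a root active after two iterations was active before them and has absorbed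
-- a second, disjoint, previously active tree.  Hence the minimum size of an active tree doubles
-- every two iterations, and once it exceeds n no root is active, connectUpdate
-- changes nothing, and the algorithm stops.  Thus S stops within 2(L + 1) + 1
-- iterations, i.e. after at most (L + 3)(2L + 3) ≤ 20 L² operations.

open import Defs
open import Data.Bool using (true; false; if_then_else_; T)
open import Data.Empty using (⊥; ⊥-elim)
open import Data.Fin using (Fin; toℕ; _≟_) renaming (zero to fzero; suc to fsuc)
open import Data.Fin.Properties using (toℕ-injective; toℕ<n; all?)
open import Data.List using ([]; _∷_)
open import Data.List.Membership.Propositional using (_∈_)
open import Data.List.Relation.Unary.Any using (here; there)
open import Data.Nat using (ℕ; zero; suc; _+_; _*_; _∸_; _^_; _≤_; _<_; _≤ᵇ_; z≤n; s≤s; ⌈_/2⌉; ⌊_/2⌋)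
open import Data.Nat.Induction using (<-rec)
open import Data.Nat.Logarithm using (⌈log₂_⌉; ⌈log₂⌉-mono-≤; ⌈log₂⌈n/2⌉⌉≡⌈log₂n⌉∸1)
open import Data.Nat.Properties hiding (_≟_)
open import Data.Nat.Tactic.RingSolver using (solve-∀)
open import Data.Product using (Σ; ∃; _×_; _,_; proj₁; proj₂)
open import Data.Sum using (_⊎_; inj₁; inj₂)
open import Data.Unit using (tt)
open import Level using (0ℓ)
open import Relation.Binary.PropositionalEquality
open import Relation.Nullary using (¬_; yes; no; does)
open import Relation.Nullary.Decidable using (_×-dec_)
open import Relation.Unary using (Pred; Decidable; _⊆_)

module _ {n : ℕ} where

  minmax-view : (a b : Fin n) →
    (toℕ a ≤ toℕ b × minF a b ≡ a × maxF a b ≡ b) ⊎ (toℕ b < toℕ a × minF a b ≡ b × maxF a b ≡ a)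
  minmax-view a b with toℕ a ≤ᵇ toℕ b in eq
  ... | true  = inj₁ (≤ᵇ⇒≤ (toℕ a) (toℕ b) (subst T (sym eq) tt) , refl , refl)
  ... | false = inj₂ (≰⇒> (λ a≤b → subst T eq (≤⇒≤ᵇ a≤b)) , refl , refl)

  min≤ˡ : (a b : Fin n) → toℕ (minF a b) ≤ toℕ a
  min≤ˡ a b with minmax-view a b
  ... | inj₁ (_ , mn , _) rewrite mn = ≤-refl
  ... | inj₂ (b<a , mn , _) rewrite mn = <⇒≤ b<a

  min≤ʳ : (a b : Fin n) → toℕ (minF a b) ≤ toℕ b
  min≤ʳ a b with minmax-view a b
  ... | inj₁ (a≤b , mn , _) rewrite mn = a≤b
  ... | inj₂ (_ , mn , _) rewrite mn = ≤-refl

  minmax-pair : ∀ {x y c d : Fin n} → toℕ y < toℕ x → (c ≡ x × d ≡ y) ⊎ (c ≡ y × d ≡ x) →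
                maxF c d ≡ x × minF c d ≡ y
  minmax-pair {x} {y} y<x (inj₁ (refl , refl)) with minmax-view x y
  ... | inj₁ (x≤y , _) = ⊥-elim (<⇒≱ y<x x≤y)
  ... | inj₂ (_ , mn , mx) = mx , mn
  minmax-pair {x} {y} y<x (inj₂ (refl , refl)) with minmax-view y x
  ... | inj₁ (_ , mn , mx) = mx , mn
  ... | inj₂ (x<y , _) = ⊥-elim (<-asym y<x x<y)

Sent : ∀ {n} → Graph n → Parents n → Fin n → Fin n → Set
Sent {n} E p v x =
  Σ (Fin n) λ a → Σ (Fin n) λ b → (a , b) ∈ E × maxF (p a) (p b) ≡ v × minF (p a) (p b) ≡ x

sent-there : ∀ {n} {E : Graph n} {e} (p : Parents n) {v x} → Sent E p v x → Sent (e ∷ E) p v x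
sent-there _ (a , b , a∈E , mx , mn) = a , b , there a∈E , mx , mn

module Received {n : ℕ} (p : Parents n) (v : Fin n) where

  received-≤-init : (E : Graph n) (acc : Fin n) → toℕ (received E p v acc) ≤ toℕ acc
  received-≤-init [] acc = ≤-refl
  received-≤-init ((a , b) ∷ E) acc with maxF (p a) (p b) ≟ v
  ... | yes _ = ≤-trans (min≤ʳ (minF (p a) (p b)) _) (received-≤-init E acc)
  ... | no  _ = received-≤-init E acc

  received-≤-sent : (E : Graph n) (acc x : Fin n) → Sent E p v x → toℕ (received E p v acc) ≤ toℕ x
  received-≤-sent ((a , b) ∷ E) acc _ (a , b , here refl , mx , refl) with maxF (p a) (p b) ≟ v
  ... | yes _ = min≤ˡ (minF (p a) (p b)) _
  ... | no mx≢v = ⊥-elim (mx≢v mx)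
  received-≤-sent ((a′ , b′) ∷ E) acc x (a , b , there ab∈E , mx , mn) with maxF (p a′) (p b′) ≟ v
  ... | yes _ = ≤-trans (min≤ʳ (minF (p a′) (p b′)) _) (received-≤-sent E acc x (a , b , ab∈E , mx , mn))
  ... | no  _ = received-≤-sent E acc x (a , b , ab∈E , mx , mn)

  received-source : (E : Graph n) (acc : Fin n) →
                    received E p v acc ≡ acc ⊎ Sent E p v (received E p v acc)
  received-source [] acc = inj₁ refl
  received-source ((a , b) ∷ E) acc with maxF (p a) (p b) ≟ v
  ... | no _ with received-source E acc
  ...   | inj₁ same = inj₁ same
  ...   | inj₂ sent = inj₂ (sent-there p sent)
  received-source ((a , b) ∷ E) acc | yes mx with minmax-view (minF (p a) (p b)) (received E p v acc)
  ... | inj₁ (_ , mn , _) = inj₂ (a , b , here refl , mx , sym mn)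
  ... | inj₂ (_ , mn , _) with received-source E acc
  ...   | inj₁ same = inj₁ (trans mn same)
  ...   | inj₂ sent = inj₂ (subst (Sent ((a , b) ∷ E) p v) (sym mn) (sent-there p sent))

-- A parent function is decreasing when parents
-- never exceed their children (so following parents reaches a root), and flat
-- when every parent is a root; root p v is the root reached from v.
module _ {n : ℕ} where

  iter : Parents n → ℕ → Fin n → Fin n
  iter p zero    v = v
  iter p (suc m) v = iter p m (p v)

  Decreasing : Parents n → Set
  Decreasing p = ∀ v → toℕ (p v) ≤ toℕ v

  Flat : Parents n → Set
  Flat p = shortcut p ≐ p

  root : Parents n → Fin n → Fin n
  root p v = iter p n v

  iter-fixed : ∀ {p v} → p v ≡ v → ∀ m → iter p m v ≡ v
  iter-fixed fixed zero = refl
  iter-fixed {p} fixed (suc m) rewrite fixed = iter-fixed fixed m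

  iter-+ : ∀ p a b (v : Fin n) → iter p (a + b) v ≡ iter p b (iter p a v)
  iter-+ p zero    b v = refl
  iter-+ p (suc a) b v = iter-+ p a b (p v)

  iter-decreasing : ∀ {p} → Decreasing p → ∀ m v → toℕ (iter p m v) ≤ toℕ v
  iter-decreasing dec zero    v = ≤-refl
  iter-decreasing dec (suc m) v = ≤-trans (iter-decreasing dec m _) (dec v)

  moves-down : ∀ {p} → Decreasing p → ∀ {v} → ¬ p v ≡ v → toℕ (p v) < toℕ v
  moves-down dec {v} moved = ≤∧≢⇒< (dec v) (λ e → moved (toℕ-injective e))

  -- From v a root is reached within toℕ v steps, since each step moves down.
  iter-settles : ∀ {p} → Decreasing p → ∀ m v → toℕ v ≤ m → p (iter p m v) ≡ iter p m v
  iter-settles {p} dec m v v≤m with p v ≟ v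
  ... | yes fixed = subst (λ w → p w ≡ w) (sym (iter-fixed fixed m)) fixed
  iter-settles dec zero    v v≤0 | no moved = ⊥-elim (n≮0 (<-≤-trans (moves-down dec moved) v≤0))
  iter-settles dec (suc m) v v≤m | no moved =
    iter-settles dec m _ (≤-pred (<-≤-trans (moves-down dec moved) v≤m))

  iter-stable : ∀ {p} → Decreasing p → ∀ {m m′} v → toℕ v ≤ m → m ≤ m′ → iter p m′ v ≡ iter p m v
  iter-stable {p} dec {m} {m′} v v≤m m≤m′ = begin
    iter p m′ v                   ≡⟨ cong (λ k → iter p k v) (sym (m+[n∸m]≡n m≤m′)) ⟩
    iter p (m + (m′ ∸ m)) v       ≡⟨ iter-+ p m (m′ ∸ m) v ⟩
    iter p (m′ ∸ m) (iter p m v)  ≡⟨ iter-fixed (iter-settles dec m v v≤m) (m′ ∸ m) ⟩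
    iter p m v                    ∎
    where open ≡-Reasoning

  root-stable : ∀ {p} → Decreasing p → ∀ {m} v → n ≤ m → iter p m v ≡ root p v
  root-stable dec v = iter-stable dec v (<⇒≤ (toℕ<n v))

  root-is-root : ∀ {p} → Decreasing p → ∀ v → p (root p v) ≡ root p v
  root-is-root dec v = iter-settles dec n v (<⇒≤ (toℕ<n v))

  root-decreasing : ∀ {p} → Decreasing p → ∀ v → toℕ (root p v) ≤ toℕ v
  root-decreasing dec = iter-decreasing dec n

  root-step : ∀ {p} → Decreasing p → ∀ v → root p (p v) ≡ root p v
  root-step dec v = root-stable dec v (n≤1+n n)

  flat-root : ∀ {p} → Flat p → Decreasing p → ∀ v → p v ≡ root p v
  flat-root flat dec v = trans (sym (iter-fixed (flat v) n)) (root-step dec v)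

  iter-shortcut : ∀ p m (v : Fin n) → iter (shortcut p) m v ≡ iter p (m + m) v
  iter-shortcut p zero    v = refl
  iter-shortcut p (suc m) v rewrite +-suc m m = iter-shortcut p m (p (p v))

  shortcut-decreasing : ∀ {p} → Decreasing p → Decreasing (shortcut p)
  shortcut-decreasing dec v = ≤-trans (dec _) (dec v)

  root-shortcut : ∀ {p} → Decreasing p → ∀ v → root (shortcut p) v ≡ root p v
  root-shortcut {p} dec v = trans (iter-shortcut p n v) (root-stable dec v (m≤m+n n n))

  last-step : ∀ {p} (P : Fin n → Set) → (∀ {v} → P v → P (p v)) →
              ∀ m {x ℓ} → P x → ¬ x ≡ ℓ → iter p m x ≡ ℓ →
              Σ (Fin n) λ δ → P δ × ¬ δ ≡ ℓ × p δ ≡ ℓ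
  last-step P closed zero Px x≢ℓ x≡ℓ = ⊥-elim (x≢ℓ x≡ℓ)
  last-step {p} P closed (suc m) {x} {ℓ} Px x≢ℓ ends with p x ≟ ℓ
  ... | yes px≡ℓ = x , Px , x≢ℓ , px≡ℓ
  ... | no px≢ℓ = last-step P closed m (closed Px) px≢ℓ ends

  shortcut-loop : ∀ s (q : Parents n) → Decreasing q → (∀ v → iter q (2 ^ s) v ≡ root q v) →
                  Σ (Parents n) λ r → Σ ℕ λ j → ShortcutLoop q r j × j ≤ suc s × r ≐ root q
  shortcut-loop s q dec reach with all? (λ v → shortcut q v ≟ q v)
  ... | yes flat = q , 1 , sc-stop flat , s≤s z≤n , flat-root flat dec
  shortcut-loop zero q dec reach | no ¬flat =
    ⊥-elim (¬flat λ v → trans (cong q (reach v)) (trans (root-is-root dec v) (sym (reach v))))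
  shortcut-loop (suc s) q dec reach | no ¬flat
    with shortcut-loop s (shortcut q) (shortcut-decreasing dec) reach′
    where
    reach′ : ∀ v → iter (shortcut q) (2 ^ s) v ≡ root (shortcut q) v
    reach′ v = begin
      iter (shortcut q) (2 ^ s) v  ≡⟨ iter-shortcut q (2 ^ s) v ⟩
      iter q (2 ^ s + 2 ^ s) v     ≡⟨ cong (λ k → iter q (2 ^ s + k) v) (sym (+-identityʳ (2 ^ s))) ⟩
      iter q (2 ^ suc s) v         ≡⟨ reach v ⟩
      root q v                     ≡⟨ sym (root-shortcut dec v) ⟩
      root (shortcut q) v          ∎
      where open ≡-Reasoning
  ... | r , j , loop , j≤ , r≐root =
    r , suc j , sc-step ¬flat loop , s≤s j≤ , λ v → trans (r≐root v) (root-shortcut dec v)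

count : ∀ {n} {P : Pred (Fin n) 0ℓ} → Decidable P → ℕ
count {zero}  P? = 0
count {suc n} P? = (if does (P? fzero) then 1 else 0) + count (λ v → P? (fsuc v))

count≤n : ∀ {n} {P : Pred (Fin n) 0ℓ} (P? : Decidable P) → count P? ≤ n
count≤n {zero}  P? = z≤n
count≤n {suc n} P? with P? fzero
... | yes _ = s≤s (count≤n (λ v → P? (fsuc v)))
... | no  _ = m≤n⇒m≤1+n (count≤n (λ v → P? (fsuc v)))

count-pos : ∀ {n} {P : Pred (Fin n) 0ℓ} (P? : Decidable P) {v} → P v → 1 ≤ count P?
count-pos {suc n} P? {v} Pv with P? fzero | v
... | yes _ | _ = s≤s z≤n
... | no ¬P0 | fzero = ⊥-elim (¬P0 Pv)
... | no _ | fsuc w = count-pos (λ u → P? (fsuc u)) Pv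

count-disjoint : ∀ {n} {P Q R : Pred (Fin n) 0ℓ} (P? : Decidable P) (Q? : Decidable Q) (R? : Decidable R) →
                 P ⊆ R → Q ⊆ R → (∀ {v} → P v → Q v → ⊥) → count P? + count Q? ≤ count R?
count-disjoint {zero} _ _ _ _ _ _ = z≤n
count-disjoint {suc n} P? Q? R? P⊆R Q⊆R disjoint with P? fzero | Q? fzero | R? fzero
... | yes P0 | yes Q0 | _     = ⊥-elim (disjoint P0 Q0)
... | yes P0 | no _  | no ¬R0 = ⊥-elim (¬R0 (P⊆R P0))
... | no _  | yes Q0 | no ¬R0 = ⊥-elim (¬R0 (Q⊆R Q0))
... | yes _ | no _  | yes _ =
  s≤s (count-disjoint (λ v → P? (fsuc v)) (λ v → Q? (fsuc v)) (λ v → R? (fsuc v)) P⊆R Q⊆R disjoint)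
... | no _  | yes _ | yes _ =
  subst (_≤ suc (count (λ v → R? (fsuc v)))) (sym (+-suc (count (λ v → P? (fsuc v))) (count (λ v → Q? (fsuc v)))))
    (s≤s (count-disjoint (λ v → P? (fsuc v)) (λ v → Q? (fsuc v)) (λ v → R? (fsuc v)) P⊆R Q⊆R disjoint))
... | no _  | no _  | yes _ =
  m≤n⇒m≤1+n (count-disjoint (λ v → P? (fsuc v)) (λ v → Q? (fsuc v)) (λ v → R? (fsuc v)) P⊆R Q⊆R disjoint)
... | no _  | no _  | no _  =
  count-disjoint (λ v → P? (fsuc v)) (λ v → Q? (fsuc v)) (λ v → R? (fsuc v)) P⊆R Q⊆R disjoint

1≤⌈log₂n⌉ : ∀ {n} → 2 ≤ n → 1 ≤ ⌈log₂ n ⌉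
1≤⌈log₂n⌉ = ⌈log₂⌉-mono-≤

n≤2^⌈log₂n⌉ : ∀ n → n ≤ 2 ^ ⌈log₂ n ⌉
n≤2^⌈log₂n⌉ = <-rec (λ n → n ≤ 2 ^ ⌈log₂ n ⌉) bound
  where
  bound : ∀ n → (∀ {m} → m < n → m ≤ 2 ^ ⌈log₂ m ⌉) → n ≤ 2 ^ ⌈log₂ n ⌉
  bound zero          _  = z≤n
  bound (suc zero)    _  = s≤s z≤n
  bound (suc (suc k)) ih = begin
    suc (suc k)                 ≡⟨ sym (⌊n/2⌋+⌈n/2⌉≡n (suc (suc k))) ⟩
    ⌊ suc (suc k) /2⌋ + h       ≤⟨ +-monoˡ-≤ h (⌊n/2⌋≤⌈n/2⌉ (suc (suc k))) ⟩
    h + h                       ≤⟨ +-mono-≤ half half ⟩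
    2 ^ (L ∸ 1) + 2 ^ (L ∸ 1)   ≡⟨ cong (λ t → 2 ^ (L ∸ 1) + t) (sym (+-identityʳ _)) ⟩
    2 ^ (1 + (L ∸ 1))           ≡⟨ cong (2 ^_) (m+[n∸m]≡n (1≤⌈log₂n⌉ {suc (suc k)} (s≤s (s≤s z≤n)))) ⟩
    2 ^ L                       ∎
    where
    open ≤-Reasoning
    h = ⌈ suc (suc k) /2⌉
    L = ⌈log₂ suc (suc k) ⌉
    half : h ≤ 2 ^ (L ∸ 1)
    half = subst (λ t → h ≤ 2 ^ t) (⌈log₂⌈n/2⌉⌉≡⌈log₂n⌉∸1 (suc (suc k))) (ih (⌈n/2⌉<n k))

module Hooking {n : ℕ} (E : Graph n) where

  hook : Parents n → Parents n
  hook = connectUpdate E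

  Link : Fin n → Fin n → Set
  Link u w = (u , w) ∈ E ⊎ (w , u) ∈ E

  Adj : Parents n → Fin n → Fin n → Set
  Adj p x y = Σ (Fin n) λ u → Σ (Fin n) λ w → Link u w × p u ≡ x × p w ≡ y

  adj-sym : ∀ {p x y} → Adj p x y → Adj p y x
  adj-sym (u , w , inj₁ uw∈E , pu , pw) = w , u , inj₂ uw∈E , pw , pu
  adj-sym (u , w , inj₂ wu∈E , pu , pw) = w , u , inj₁ wu∈E , pw , pu

  Active : Parents n → Fin n → Set
  Active p ℓ = p ℓ ≡ ℓ × Σ (Fin n) λ y → ¬ y ≡ ℓ × Adj p ℓ y

  sent⇒adj : ∀ {p v x} → Sent E p v x → Adj p v x
  sent⇒adj {p} (a , b , ab∈E , mx , mn) with minmax-view (p a) (p b)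
  ... | inj₁ (_ , mn′ , mx′) = b , a , inj₂ ab∈E , trans (sym mx′) mx , trans (sym mn′) mn
  ... | inj₂ (_ , mn′ , mx′) = a , b , inj₁ ab∈E , trans (sym mx′) mx , trans (sym mn′) mn

  adj⇒sent : ∀ {p x y} → Adj p x y → toℕ y < toℕ x → Sent E p x y
  adj⇒sent (u , w , inj₁ uw∈E , pu , pw) y<x = u , w , uw∈E , minmax-pair y<x (inj₁ (pu , pw))
  adj⇒sent (u , w , inj₂ wu∈E , pu , pw) y<x = w , u , wu∈E , minmax-pair y<x (inj₂ (pw , pu))

  hook-root : ∀ {p v} → p v ≡ v → hook p v ≡ received E p v v
  hook-root {p} {v} isRoot with p v ≟ v
  ... | yes pv≡v = cong (received E p v) pv≡v
  ... | no  moved = ⊥-elim (moved isRoot)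

  hook-nonroot : ∀ {p v} → ¬ p v ≡ v → hook p v ≡ p v
  hook-nonroot {p} {v} moved with p v ≟ v
  ... | yes isRoot = ⊥-elim (moved isRoot)
  ... | no  _ = refl

  hook-cases : ∀ p v → hook p v ≡ p v ⊎ (p v ≡ v × Sent E p v (hook p v))
  hook-cases p v with p v ≟ v
  ... | no _ = inj₁ refl
  ... | yes isRoot with Received.received-source p v E (p v)
  ...   | inj₁ same = inj₁ same
  ...   | inj₂ sent = inj₂ (isRoot , sent)

  hook-≤ : ∀ p v → toℕ (hook p v) ≤ toℕ (p v)
  hook-≤ p v with p v ≟ v
  ... | yes _ = Received.received-≤-init p v E (p v)
  ... | no  _ = ≤-refl

  hook-decreasing : ∀ {p} → Decreasing p → Decreasing (hook p)
  hook-decreasing {p} dec v = ≤-trans (hook-≤ p v) (dec v)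

  hook-≤-sent : ∀ {p v x} → p v ≡ v → Sent E p v x → toℕ (hook p v) ≤ toℕ x
  hook-≤-sent {p} {v} {x} isRoot sent =
    subst (λ z → toℕ z ≤ toℕ x) (sym (hook-root {p} isRoot)) (Received.received-≤-sent p v E v x sent)

  unhooked-minimal : ∀ {p ℓ y} → p ℓ ≡ ℓ → hook p ℓ ≡ ℓ → Adj p ℓ y → toℕ ℓ ≤ toℕ y
  unhooked-minimal {p} {ℓ} {y} isRoot unhooked adj = ≮⇒≥ λ y<ℓ →
    <⇒≱ y<ℓ (subst (λ z → toℕ z ≤ toℕ y) unhooked (hook-≤-sent {p} isRoot (adj⇒sent {p} adj y<ℓ)))

  hook-to-root : ∀ {p} → Flat p → ∀ v → p (hook p v) ≡ hook p v
  hook-to-root {p} flat v with hook-cases p v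
  ... | inj₁ same = subst (λ z → p z ≡ z) (sym same) (flat v)
  ... | inj₂ (_ , sent) with sent⇒adj sent
  ...   | _ , w , _ , _ , pw = subst (λ z → p z ≡ z) pw (flat w)

  inactive-fixed : ∀ {p} → (∀ ℓ → ¬ Active p ℓ) → hook p ≐ p
  inactive-fixed {p} inactive v with hook-cases p v
  ... | inj₁ same = same
  ... | inj₂ (isRoot , sent) with hook p v ≟ v
  ...   | yes unhooked = trans unhooked (sym isRoot)
  ...   | no  hooked = ⊥-elim (inactive v (isRoot , hook p v , hooked , sent⇒adj sent))

  -- s₁ is the forest after one iteration from s: hook, then shortcut to the roots.
  Next : Parents n → Parents n → Set
  Next s s₁ = s₁ ≐ root (hook s)

  module Round {s s₁ : Parents n} (flat : Flat s) (dec : Decreasing s) (next : Next s s₁) where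

    private
      q : Parents n
      q = hook s

      q-dec : Decreasing q
      q-dec = hook-decreasing dec

    next-decreasing : Decreasing s₁
    next-decreasing v = subst (λ z → toℕ z ≤ toℕ v) (sym (next v)) (root-decreasing q-dec v)

    next-flat : Flat s₁
    next-flat v = begin
      s₁ (s₁ v)          ≡⟨ next (s₁ v) ⟩
      root q (s₁ v)      ≡⟨ cong (root q) (next v) ⟩
      root q (root q v)  ≡⟨ iter-fixed (root-is-root q-dec v) n ⟩
      root q v           ≡⟨ sym (next v) ⟩
      s₁ v               ∎
      where open ≡-Reasoning

    next-on-trees : ∀ v → s₁ v ≡ s₁ (s v)
    next-on-trees v with s v ≟ v
    ... | yes isRoot = cong s₁ (sym isRoot)
    ... | no  moved = begin
      s₁ v          ≡⟨ next v ⟩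
      root q v      ≡⟨ sym (root-step q-dec v) ⟩
      root q (q v)  ≡⟨ cong (root q) (hook-nonroot {s} moved) ⟩
      root q (s v)  ≡⟨ sym (next (s v)) ⟩
      s₁ (s v)      ∎
      where open ≡-Reasoning

    next-≤-hook : ∀ v → toℕ (s₁ v) ≤ toℕ (q v)
    next-≤-hook v = subst (λ z → toℕ z ≤ toℕ (q v)) (sym (trans (next v) (sym (root-step q-dec v))))
                          (root-decreasing q-dec (q v))

    next-root : ∀ {ℓ} → s₁ ℓ ≡ ℓ → s ℓ ≡ ℓ × q ℓ ≡ ℓ
    next-root {ℓ} isRoot₁ =
      toℕ-injective (≤-antisym (dec ℓ) (≤-trans ℓ≤qℓ (hook-≤ s ℓ))) ,
      toℕ-injective (≤-antisym (q-dec ℓ) ℓ≤qℓ)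
      where
      ℓ≤qℓ : toℕ ℓ ≤ toℕ (q ℓ)
      ℓ≤qℓ = subst (λ z → toℕ z ≤ toℕ (q ℓ)) isRoot₁ (next-≤-hook ℓ)

    -- A root of s₁ that absorbs another root x of s was active in s: the path
    -- of hooks from x ends with some root δ hooked directly onto ℓ.
    absorbed⇒active : ∀ {ℓ x} → s₁ ℓ ≡ ℓ → s x ≡ x → ¬ x ≡ ℓ → s₁ x ≡ ℓ → Active s ℓ
    absorbed⇒active {ℓ} {x} isRoot₁ isRoot x≢ℓ absorbed
      with last-step (λ v → s v ≡ v) (λ {v} _ → hook-to-root flat v) n isRoot x≢ℓ (trans (sym (next x)) absorbed)
    ... | δ , δ-root , δ≢ℓ , qδ≡ℓ with hook-cases s δ
    ...   | inj₁ same = ⊥-elim (δ≢ℓ (trans (sym δ-root) (trans (sym same) qδ≡ℓ)))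
    ...   | inj₂ (_ , sent) =
      proj₁ (next-root isRoot₁) , δ , δ≢ℓ , adj-sym (subst (Adj s δ) qδ≡ℓ (sent⇒adj sent))

    active-before : ∀ {ℓ} → Active s₁ ℓ → Active s ℓ
    active-before {ℓ} (isRoot₁ , y , y≢ℓ , u , w , link , s₁u≡ℓ , s₁w≡y) with s u ≟ ℓ
    ... | yes su≡ℓ = proj₁ (next-root isRoot₁) , s w , sw≢ℓ , u , w , link , su≡ℓ , refl
      where
      sw≢ℓ : ¬ s w ≡ ℓ
      sw≢ℓ sw≡ℓ = y≢ℓ (trans (sym s₁w≡y) (trans (next-on-trees w) (trans (cong s₁ sw≡ℓ) isRoot₁)))
    ... | no su≢ℓ = absorbed⇒active isRoot₁ (flat u) su≢ℓ (trans (sym (next-on-trees u)) s₁u≡ℓ)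

  size : Parents n → Fin n → ℕ
  size p ℓ = count (λ v → p v ≟ ℓ)

  ActiveSize : Parents n → ℕ → Set
  ActiveSize p m = ∀ ℓ → Active p ℓ → m ≤ size p ℓ

  module TwoRounds {s s₁ s₂ : Parents n} (flat : Flat s) (dec : Decreasing s)
                   (next₁ : Next s s₁) (next₂ : Next s₁ s₂) where

    private
      module R₁ = Round flat dec next₁
      module R₂ = Round R₁.next-flat R₁.next-decreasing next₂

    flat₂ : Flat s₂
    flat₂ = R₂.next-flat

    dec₂ : Decreasing s₂
    dec₂ = R₂.next-decreasing

    on-trees : ∀ v → s₂ v ≡ s₂ (s v)
    on-trees v = trans (R₂.next-on-trees v) (trans (cong s₂ (R₁.next-on-trees v)) (sym (R₂.next-on-trees (s v))))

    -- A root ℓ surviving both iterations has no edge in s from its own tree to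
    -- a vertex w that ends outside the tree of ℓ: otherwise the tree β of w
    -- (with ℓ < β, as ℓ stayed unhooked) would be hooked below ℓ in the first
    -- iteration, and ℓ would be hooked onto it in the second.
    survivor-isolated : ∀ {ℓ u w} → s₂ ℓ ≡ ℓ → Link u w → s u ≡ ℓ → ¬ s₂ w ≡ ℓ → ⊥
    survivor-isolated {ℓ} {u} {w} isRoot₂ link su≡ℓ s₂w≢ℓ =
      s₁w≢ℓ (toℕ-injective (≤-antisym s₁w≤ℓ ℓ≤s₁w))
      where
      isRoot₁ = proj₁ (R₂.next-root isRoot₂)
      unhooked₂ = proj₂ (R₂.next-root isRoot₂)
      isRoot = proj₁ (R₁.next-root isRoot₁)
      unhooked₁ = proj₂ (R₁.next-root isRoot₁)
      β≢ℓ : ¬ s w ≡ ℓ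
      β≢ℓ sw≡ℓ = s₂w≢ℓ (trans (on-trees w) (trans (cong s₂ sw≡ℓ) isRoot₂))
      ℓ<β : toℕ ℓ < toℕ (s w)
      ℓ<β = ≤∧≢⇒< (unhooked-minimal {s} isRoot unhooked₁ (u , w , link , su≡ℓ , refl))
                   (λ e → β≢ℓ (toℕ-injective (sym e)))
      s₁w≤ℓ : toℕ (s₁ w) ≤ toℕ ℓ
      s₁w≤ℓ = subst (λ z → toℕ z ≤ toℕ ℓ) (sym (R₁.next-on-trees w))
                (≤-trans (R₁.next-≤-hook (s w))
                  (hook-≤-sent {s} (flat w) (adj⇒sent {s} (adj-sym (u , w , link , su≡ℓ , refl)) ℓ<β)))
      s₁w≢ℓ : ¬ s₁ w ≡ ℓ
      s₁w≢ℓ s₁w≡ℓ = s₂w≢ℓ (trans (R₂.next-on-trees w) (trans (cong s₂ s₁w≡ℓ) isRoot₂))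
      ℓ≤s₁w : toℕ ℓ ≤ toℕ (s₁ w)
      ℓ≤s₁w = unhooked-minimal {s₁} isRoot₁ unhooked₂
                (u , w , link , trans (R₁.next-on-trees u) (trans (cong s₁ su≡ℓ) isRoot₁) , refl)

    merge : ∀ {ℓ} → Active s₂ ℓ → Σ (Fin n) λ α → ¬ α ≡ ℓ × Active s α × s₂ α ≡ ℓ
    merge {ℓ} (isRoot₂ , y , y≢ℓ , u , w , link , s₂u≡ℓ , s₂w≡y) = s u , α≢ℓ , α-active , s₂α≡ℓ
      where
      s₂w≢ℓ : ¬ s₂ w ≡ ℓ
      s₂w≢ℓ s₂w≡ℓ = y≢ℓ (trans (sym s₂w≡y) s₂w≡ℓ)
      α≢ℓ : ¬ s u ≡ ℓ
      α≢ℓ su≡ℓ = survivor-isolated isRoot₂ link su≡ℓ s₂w≢ℓ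
      s₂α≡ℓ : s₂ (s u) ≡ ℓ
      s₂α≡ℓ = trans (sym (on-trees u)) s₂u≡ℓ
      α-active : Active s (s u)
      α-active = flat u , s w ,
        (λ sw≡su → s₂w≢ℓ (trans (on-trees w) (trans (cong s₂ sw≡su) s₂α≡ℓ))) ,
        u , w , link , refl , refl

    -- Hence the active trees of s₂ contain two disjoint active trees of s.
    doubling : ∀ {m} → ActiveSize s m → ActiveSize s₂ (m + m)
    doubling {m} big ℓ active with merge active
    ... | α , α≢ℓ , α-active , s₂α≡ℓ = begin
      m + m                  ≤⟨ +-mono-≤ (big α α-active) (big ℓ (R₁.active-before (R₂.active-before active))) ⟩
      size s α + size s ℓ    ≤⟨ count-disjoint (λ v → s v ≟ α) (λ v → s v ≟ ℓ) (λ v → s₂ v ≟ ℓ)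
                                  into-ℓ from-ℓ (λ e₁ e₂ → α≢ℓ (trans (sym e₁) e₂)) ⟩
      size s₂ ℓ              ∎
      where
      open ≤-Reasoning
      into-ℓ : ∀ {v} → s v ≡ α → s₂ v ≡ ℓ
      into-ℓ {v} sv≡α = trans (on-trees v) (trans (cong s₂ sv≡α) s₂α≡ℓ)
      from-ℓ : ∀ {v} → s v ≡ ℓ → s₂ v ≡ ℓ
      from-ℓ {v} sv≡ℓ = trans (on-trees v) (trans (cong s₂ sv≡ℓ) (proj₁ active))

  Within : Parents n → ℕ → Set
  Within s b = ∃ λ k → RunS E s k × k ≤ b

  within-≤ : ∀ {s a b} → a ≤ b → Within s a → Within s b
  within-≤ a≤b (k , run , k≤a) = k , run , ≤-trans k≤a a≤b

  module Cost (L : ℕ) (n≤2^L : n ≤ 2 ^ L) where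

    -- An iteration takes parent-connect, root-update and at most L + 1 shortcuts.
    C : ℕ
    C = L + 3

    iteration : ∀ {s} → Decreasing s →
                Σ (Parents n) λ r → Σ ℕ λ j → ShortcutLoop (hook s) r j × 2 + j ≤ C × Next s r
    iteration {s} dec
      with shortcut-loop L (hook s) (hook-decreasing dec) (λ v → root-stable (hook-decreasing dec) v n≤2^L)
    ... | r , j , loop , j≤1+L , r≐root =
      r , j , loop , subst (2 + j ≤_) (+-comm 3 L) (s≤s (s≤s j≤1+L)) , r≐root

    one-more : ∀ {s} b → Decreasing s → (∀ {r} → Next s r → Within r b) → Within s (C + b)
    one-more {s} b dec continue with iteration dec
    ... | r , j , loop , cost , next with all? (λ v → hook s v ≟ s v) ×-dec all? (λ v → r v ≟ hook s v)
    ...   | yes (unchanged , settled) = 2 + j , run-stop unchanged loop settled , ≤-trans cost (m≤m+n C b)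
    ...   | no  changed with continue next
    ...     | k , run , k≤b = 2 + j + k , run-step loop changed run , +-mono-≤ cost k≤b

    stop : ∀ {s} → Flat s → (∀ ℓ → ¬ Active s ℓ) → Within s C
    stop {s} flat inactive = 3 , run-stop unchanged (sc-stop hook-flat) (λ _ → refl) , m≤n+m 3 L
      where
      unchanged : hook s ≐ s
      unchanged = inactive-fixed inactive
      hook-flat : Flat (hook s)
      hook-flat v = begin
        hook s (hook s v)  ≡⟨ unchanged (hook s v) ⟩
        s (hook s v)       ≡⟨ cong s (unchanged v) ⟩
        s (s v)            ≡⟨ flat v ⟩
        s v                ≡⟨ sym (unchanged v) ⟩
        hook s v           ∎
        where open ≡-Reasoning

    budget : ℕ → ℕ
    budget i = C + i * (C + C)

    double-weight : ∀ a m → 2 * a * m ≡ a * (m + m)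
    double-weight = solve-∀

    -- If active trees have at least m vertices and n < 2 ^ i * m, then S stops
    -- within 2i + 1 iterations: each pair of iterations doubles m.
    run : ∀ i {s} m → Flat s → Decreasing s → ActiveSize s m → n < 2 ^ i * m → Within s (budget i)
    run zero {s} m flat dec big n<m = within-≤ (m≤m+n C 0) (stop flat inactive)
      where
      inactive : ∀ ℓ → ¬ Active s ℓ
      inactive ℓ active = <⇒≱ (subst (n <_) (+-identityʳ m) n<m)
                                (≤-trans (big ℓ active) (count≤n (λ v → s v ≟ ℓ)))
    run (suc i) {s} m flat dec big n<2m =
      within-≤ (≤-reflexive (cong (C +_) (sym (+-assoc C C (i * (C + C))))))
        (one-more (C + budget i) dec λ next₁ →
          one-more (budget i) (Round.next-decreasing flat dec next₁) (after-two next₁))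
      where
      after-two : ∀ {s₁ s₂} → Next s s₁ → Next s₁ s₂ → Within s₂ (budget i)
      after-two next₁ next₂ =
        run i (m + m) flat₂ dec₂ (doubling big) (subst (n <_) (double-weight (2 ^ i) m) n<2m)
        where open TwoRounds flat dec next₁ next₂

budget-bound : ∀ L → 1 ≤ L → (L + 3) + suc L * ((L + 3) + (L + 3)) ≤ 20 * L ^ 2
budget-bound L 1≤L = begin
  (L + 3) + suc L * ((L + 3) + (L + 3))  ≡⟨ factor L ⟩
  (L + 3) * (2 * L + 3)                  ≤⟨ *-mono-≤ (+-monoʳ-≤ L (*-monoʳ-≤ 3 1≤L))
                                                     (+-monoʳ-≤ (2 * L) (*-monoʳ-≤ 3 1≤L)) ⟩
  (L + 3 * L) * (2 * L + 3 * L)          ≡⟨ square L ⟩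
  20 * L ^ 2                             ∎
  where
  open ≤-Reasoning
  factor : ∀ L → (L + 3) + suc L * ((L + 3) + (L + 3)) ≡ (L + 3) * (2 * L + 3)
  factor = solve-∀
  square : ∀ L → (L + 3 * L) * (2 * L + 3 * L) ≡ 20 * (L * (L * 1))
  square = solve-∀

theorem5 : Σ ℕ λ c → ∀ (n : ℕ) → 2 ≤ n → (E : Graph n) →
    ∃ λ k → RunS E initial k × k ≤ c * (⌈log₂ n ⌉ ^ 2)
theorem5 = 20 , bound
  where
  bound : ∀ n → 2 ≤ n → (E : Graph n) → ∃ λ k → RunS E initial k × k ≤ 20 * (⌈log₂ n ⌉ ^ 2)
  bound n 2≤n E =
    within-≤ (budget-bound L (1≤⌈log₂n⌉ 2≤n))
      (run (suc L) 1 (λ _ → refl) (λ _ → ≤-refl) singletons n<2^[1+L])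
    where
    L : ℕ
    L = ⌈log₂ n ⌉
    open Hooking E
    open Cost L (n≤2^⌈log₂n⌉ n)
    singletons : ActiveSize initial 1
    singletons ℓ _ = count-pos (λ v → initial v ≟ ℓ) refl
    n<2^[1+L] : n < 2 ^ suc L * 1
    n<2^[1+L] = subst (n <_) (sym (*-identityʳ _))
                  (≤-<-trans (n≤2^⌈log₂n⌉ n) (^-monoʳ-< 2 (s≤s (s≤s z≤n)) (n<1+n L)))
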